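{- Let $\mathcal F\subseteq\mathcal P([n])$ be $\mathcal N$-saturated and let $\mathcal G$ be a component of $\mathcal F$, with minimal elements $B_1,\dots,B_l$ and maximal elements $A_1,\dots,A_k$. Let $M\in\mathcal F$ be such that $\bigcup_{i=1}^lB_i\subseteq M\subseteq\bigcap_{i=1}^kA_i$, and such that $M$ is minimal (under inclusion) among elements of $\mathcal F$ with this property. Then every $X\in\mathcal G$ is comparable to $M$.
   Context: $[n]=\{1,\dots,n\}$, $\mathcal P([n])$ its power set ordered by inclusion. The poset $\mathcal N$ has four elements $a,b,c,d$ with $a<c$, $b<c$, $b<d$ and no other comparabilities. A family contains an induced copy of $\mathcal N$ if it contains distinct sets $P,Q,R,S$ with $P\subset R$, $Q\subset R$, $Q\subset S$ and each of the pairs $\{P,Q\},\{P,S\},\{R,S\}$ incomparable. $\mathcal F$ is $\mathcal N$-saturated if it contains no induced copy of $\mathcal N$ but $\mathcal F\cup\{X\}$ contains one for every $X\in\mathcal P([n])\setminus\mathcal F$. A component of $\mathcal F$ is the vertex set of a connected component of the Hasse diagram of $(\mathcal F\setminus\{\emptyset,[n]\},\subseteq)$ viewed as an undirected graph; its minimal and maximal elements are taken with respect to inclusion within the component. -}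

module Defs where

open import Data.Nat using (ℕ)
open import Data.Bool using (Bool; true; false)
open import Data.Fin.Subset using (Subset; _⊆_; _⊂_; ⊥; ⊤)
open import Data.Product using (_×_; Σ; ∃-syntax)
open import Data.Sum using (_⊎_)
open import Relation.Nullary using (¬_)
open import Relation.Binary.PropositionalEquality using (_≡_; _≢_)

Family : ℕ → Set
Family n = Subset n → Bool

_∈F_ : ∀ {n} → Subset n → Family n → Set
X ∈F F = F X ≡ true

Incomparable : ∀ {n} → Subset n → Subset n → Set
Incomparable X Y = ¬ (X ⊆ Y) × ¬ (Y ⊆ X)

ContainsN : ∀ {n} → (Subset n → Set) → Set
ContainsN {n} 𝓕 =
  Σ (Subset n) λ P → Σ (Subset n) λ Q → Σ (Subset n) λ R → Σ (Subset n) λ S →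
    𝓕 P × 𝓕 Q × 𝓕 R × 𝓕 S ×
    P ⊂ R × Q ⊂ R × Q ⊂ S ×
    Incomparable P Q × Incomparable P S × Incomparable R S

Insert : ∀ {n} → Family n → Subset n → Subset n → Set
Insert F X Y = Y ∈F F ⊎ Y ≡ X

NSaturated : ∀ {n} → Family n → Set
NSaturated {n} F =
  ¬ ContainsN (λ Y → Y ∈F F) ×
  (∀ (X : Subset n) → F X ≡ false → ContainsN (Insert F X))

Inner : ∀ {n} → Family n → Subset n → Set
Inner F X = X ∈F F × X ≢ ⊥ × X ≢ ⊤

Covers : ∀ {n} → Family n → Subset n → Subset n → Set
Covers {n} F X Y =
  Inner F X × Inner F Y × X ⊂ Y ×
  (∀ (Z : Subset n) → Inner F Z → X ⊂ Z → ¬ (Z ⊂ Y))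

HasseEdge : ∀ {n} → Family n → Subset n → Subset n → Set
HasseEdge F X Y = Covers F X Y ⊎ Covers F Y X

data Connected {n : ℕ} (F : Family n) : Subset n → Subset n → Set where
  here  : ∀ {X} → Inner F X → Connected F X X
  step  : ∀ {X Y Z} → Connected F X Y → HasseEdge F Y Z → Connected F X Z

InComponent : ∀ {n} → Family n → Subset n → Subset n → Set
InComponent F X₀ Y = Connected F X₀ Y

MinimalIn : ∀ {n} → (Subset n → Set) → Subset n → Set
MinimalIn {n} 𝓖 B = 𝓖 B × (∀ (Y : Subset n) → 𝓖 Y → ¬ (Y ⊂ B))

MaximalIn : ∀ {n} → (Subset n → Set) → Subset n → Set
MaximalIn {n} 𝓖 A = 𝓖 A × (∀ (Y : Subset n) → 𝓖 Y → ¬ (A ⊂ Y))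

Between : ∀ {n} → (Subset n → Set) → Subset n → Set
Between {n} 𝓖 M =
  (∀ (B : Subset n) → MinimalIn 𝓖 B → B ⊆ M) ×
  (∀ (A : Subset n) → MaximalIn 𝓖 A → M ⊆ A)

-- Call a set of F a candidate if it lies between the minimal and the maximal
-- elements of the component G. A set of G incomparable to a candidate is
-- itself a candidate: otherwise a minimal (or maximal) element of G would
-- complete an induced N. Hence every set of G is comparable to the
-- intersection W of all candidates. If W were not in F, saturation would give
-- an N in F ∪ {W} through W. Comparable sets of F ∖ {∅, [n]} lie in the same
-- component, and W is sandwiched between the extreme elements of G, so the
-- other sets of that N lie in G and are comparable to W; but no element of N
-- is comparable to all the others. So W is the least candidate, i.e. W = M.
-- Membership in G is not decidable constructively, so the argument runs under
-- double negation; this suffices because the conclusion is decidable.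
module Submission where

open import Defs
open import Data.Empty using (⊥-elim)
open import Data.Nat using (ℕ)
open import Data.Bool using (true; false)
import Data.Bool as Bool
open import Data.Fin using (Fin)
open import Data.Fin.Subset using (Subset; _⊆_; _⊂_; _⊃_; _∈_; _∉_; inside; outside; ⊥; ⊤)
open import Data.Fin.Subset.Properties
  using (_⊆?_; _⊂?_; _∈?_; ⊆-refl; ⊆-trans; ⊆-antisym; p⊂q⇒p⊆q; ⊥⊆; ⊆⊤; anySubset?)
open import Data.Fin.Subset.Induction using (⊂-wellFounded; ⊃-wellFounded)
open import Data.Product using (_×_; _,_; proj₁; proj₂; ∃; swap)
open import Data.Sum using (_⊎_; inj₁; inj₂; [_,_])
import Data.Sum as Sum
open import Data.Vec using ([]; _∷_; tabulate)
open import Data.Vec.Properties using (≡-dec; lookup∘tabulate; []=⇒lookup; lookup⇒[]=)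
open import Effect.Monad using (RawMonad)
open import Function using (_∘_)
open import Induction.WellFounded using (Acc; acc)
open import Relation.Binary.PropositionalEquality using (_≡_; _≢_; refl; sym; trans; subst)
open import Relation.Nullary using (¬_; Dec; yes; no; does)
open import Relation.Nullary.Decidable
  using (_×-dec_; _⊎-dec_; ¬?; decidable-stable; dec-true; ¬¬-excluded-middle)
open import Relation.Nullary.Negation using (DoubleNegation; ¬¬-Monad; contradiction)
open import Relation.Unary using (Decidable)

module _ {n : ℕ} where

  ⊆∧⊄⇒⊇ : {p q : Subset n} → p ⊆ q → ¬ p ⊂ q → q ⊆ p
  ⊆∧⊄⇒⊇ {p} p⊆q p⊄q {x} x∈q =
    decidable-stable (x ∈? p) λ x∉p → p⊄q (p⊆q , x , x∈q , x∉p)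

  ⊆∧⊉⇒⊂ : {p q : Subset n} → p ⊆ q → ¬ q ⊆ p → p ⊂ q
  ⊆∧⊉⇒⊂ {p} {q} p⊆q q⊈p = decidable-stable (p ⊂? q) λ p⊄q → q⊈p (⊆∧⊄⇒⊇ p⊆q p⊄q)

  Comparable : Subset n → Subset n → Set
  Comparable X Y = X ⊆ Y ⊎ Y ⊆ X

  comparable? : (X Y : Subset n) → Dec (Comparable X Y)
  comparable? X Y = X ⊆? Y ⊎-dec Y ⊆? X

  incomparable⇒¬comparable : {X Y : Subset n} → Incomparable X Y → ¬ Comparable X Y
  incomparable⇒¬comparable (X⊈Y , Y⊈X) = [ X⊈Y , Y⊈X ]

  incomparable⇒nontrivial : {X Y : Subset n} → Incomparable X Y → X ≢ ⊥ × X ≢ ⊤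
  incomparable⇒nontrivial (X⊈Y , Y⊈X) = (λ { refl → X⊈Y ⊥⊆ }) , (λ { refl → Y⊈X ⊆⊤ })

  N-intro : {𝓕 : Subset n → Set} {P Q R S : Subset n} →
    𝓕 P → 𝓕 Q → 𝓕 R → 𝓕 S → P ⊆ R → Q ⊆ R → Q ⊆ S →
    Incomparable P Q → Incomparable P S → Incomparable R S → ContainsN 𝓕
  N-intro {P = P} {Q} {R} {S} 𝓕P 𝓕Q 𝓕R 𝓕S P⊆R Q⊆R Q⊆S P∥Q P∥S R∥S =
    P , Q , R , S , 𝓕P , 𝓕Q , 𝓕R , 𝓕S ,
    ⊆∧⊉⇒⊂ P⊆R (λ R⊆P → proj₂ P∥Q (⊆-trans Q⊆R R⊆P)) ,
    ⊆∧⊉⇒⊂ Q⊆R (λ R⊆Q → proj₁ P∥Q (⊆-trans P⊆R R⊆Q)) ,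
    ⊆∧⊉⇒⊂ Q⊆S (λ S⊆Q → proj₂ R∥S (⊆-trans S⊆Q Q⊆R)) ,
    P∥Q , P∥S , R∥S

¬¬-decidable : ∀ {n} (P : Subset n → Set) → DoubleNegation (Decidable P)
¬¬-decidable {ℕ.zero} P = do
    P[]? ← ¬¬-excluded-middle
    return λ { [] → P[]? }
  where open RawMonad ¬¬-Monad
¬¬-decidable {ℕ.suc n} P = do
    P-in? ← ¬¬-decidable (P ∘ (inside ∷_))
    P-out? ← ¬¬-decidable (P ∘ (outside ∷_))
    return λ { (inside ∷ p) → P-in? p ; (outside ∷ p) → P-out? p }
  where open RawMonad ¬¬-Monad

module _ {n : ℕ} {P : Subset n → Set} where

  MinimalIn⇒⊆⇒⊇ : ∀ {B Z} → MinimalIn P B → P Z → Z ⊆ B → B ⊆ Z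
  MinimalIn⇒⊆⇒⊇ (_ , B-min) PZ Z⊆B = ⊆∧⊄⇒⊇ Z⊆B (B-min _ PZ)

  MaximalIn⇒⊇⇒⊆ : ∀ {A Z} → MaximalIn P A → P Z → A ⊆ Z → Z ⊆ A
  MaximalIn⇒⊇⇒⊆ (_ , A-max) PZ A⊆Z = ⊆∧⊄⇒⊇ A⊆Z (A-max _ PZ)

  module _ (P? : Decidable P) where

    minimal-below : ∀ {Y} → P Y → ∃ λ B → MinimalIn P B × B ⊆ Y
    minimal-below {Y} = go (⊂-wellFounded Y)
      where
      go : ∀ {Y} → Acc _⊂_ Y → P Y → ∃ λ B → MinimalIn P B × B ⊆ Y
      go {Y} (acc rec) PY with anySubset? (λ Z → P? Z ×-dec Z ⊂? Y)
      ... | yes (Z , PZ , Z⊂Y) =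
        let B , B-min , B⊆Z = go (rec Z⊂Y) PZ in B , B-min , ⊆-trans B⊆Z (p⊂q⇒p⊆q Z⊂Y)
      ... | no ∄Z = Y , (PY , λ Z PZ Z⊂Y → ∄Z (Z , PZ , Z⊂Y)) , ⊆-refl

    maximal-above : ∀ {Y} → P Y → ∃ λ A → MaximalIn P A × Y ⊆ A
    maximal-above {Y} = go (⊃-wellFounded Y)
      where
      go : ∀ {Y} → Acc _⊃_ Y → P Y → ∃ λ A → MaximalIn P A × Y ⊆ A
      go {Y} (acc rec) PY with anySubset? (λ Z → P? Z ×-dec Y ⊂? Z)
      ... | yes (Z , PZ , Y⊂Z) =
        let A , A-max , Z⊆A = go (rec Y⊂Z) PZ in A , A-max , ⊆-trans (p⊂q⇒p⊆q Y⊂Z) Z⊆A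
      ... | no ∄Z = Y , (PY , λ Z PZ Y⊂Z → ∄Z (Z , PZ , Y⊂Z)) , ⊆-refl

module _ {n : ℕ} where

  fromDec : {P : Fin n → Set} → Decidable P → Subset n
  fromDec P? = tabulate (does ∘ P?)

  module _ {P : Fin n → Set} (P? : Decidable P) {i : Fin n} where

    ∈-fromDec⁺ : P i → i ∈ fromDec P?
    ∈-fromDec⁺ Pi = lookup⇒[]= i _ (trans (lookup∘tabulate (does ∘ P?) i) (dec-true (P? i) Pi))

    ∈-fromDec⁻ : i ∈ fromDec P? → P i
    ∈-fromDec⁻ i∈ with P? i | trans (sym (lookup∘tabulate (does ∘ P?) i)) ([]=⇒lookup i∈)
    ... | yes Pi | _ = Pi
    ... | no _ | ()

  missing? : {K : Subset n → Set} → Decidable K → Decidable λ i → ∃ λ w → K w × i ∉ w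
  missing? K? i = anySubset? λ w → K? w ×-dec ¬? (i ∈? w)

  intersection : {K : Subset n → Set} → Decidable K → Subset n
  intersection K? = fromDec (¬? ∘ missing? K?)

  module _ {K : Subset n → Set} (K? : Decidable K) where

    intersection-⊆ : ∀ {w} → K w → intersection K? ⊆ w
    intersection-⊆ {w} Kw {i} i∈⋂ =
      decidable-stable (i ∈? w) λ i∉w → ∈-fromDec⁻ (¬? ∘ missing? K?) i∈⋂ (w , Kw , i∉w)

    ⊆-intersection : ∀ {Y} → (∀ {w} → K w → Y ⊆ w) → Y ⊆ intersection K?
    ⊆-intersection Y⊆K i∈Y = ∈-fromDec⁺ (¬? ∘ missing? K?) λ (w , Kw , i∉w) → i∉w (Y⊆K Kw i∈Y)

module _ {n : ℕ} {F : Family n} where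

  Inner? : Decidable (Inner F)
  Inner? Z = F Z Bool.≟ true ×-dec ¬? (≡-dec Bool._≟_ Z ⊥) ×-dec ¬? (≡-dec Bool._≟_ Z ⊤)

  HasseEdge-source : ∀ {X Y} → HasseEdge F X Y → Inner F X
  HasseEdge-source (inj₁ (iX , _)) = iX
  HasseEdge-source (inj₂ (_ , iX , _)) = iX

  HasseEdge⇒Connected : ∀ {X Y} → HasseEdge F X Y → Connected F X Y
  HasseEdge⇒Connected e = step (here (HasseEdge-source e)) e

  Connected-inner : ∀ {X Y} → Connected F X Y → Inner F Y
  Connected-inner (here iX) = iX
  Connected-inner (step _ e) = HasseEdge-source (Sum.swap e)

  Connected-trans : ∀ {X Y Z} → Connected F X Y → Connected F Y Z → Connected F X Z
  Connected-trans X~Y (here _) = X~Y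
  Connected-trans X~Y (step Y~Z e) = step (Connected-trans X~Y Y~Z) e

  Connected-sym : ∀ {X Y} → Connected F X Y → Connected F Y X
  Connected-sym (here iX) = here iX
  Connected-sym (step X~Y e) =
    Connected-trans (HasseEdge⇒Connected (Sum.swap e)) (Connected-sym X~Y)

  ⊂⇒Connected : ∀ {U V} → Inner F U → Inner F V → U ⊂ V → Connected F U V
  ⊂⇒Connected {U} {V} = go (⊃-wellFounded U) (⊂-wellFounded V)
    where
    go : ∀ {U V} → Acc _⊃_ U → Acc _⊂_ V → Inner F U → Inner F V → U ⊂ V → Connected F U V
    go {U} {V} (acc recU) (acc recV) iU iV U⊂V
      with anySubset? (λ Z → Inner? Z ×-dec U ⊂? Z ×-dec Z ⊂? V)
    ... | yes (Z , iZ , U⊂Z , Z⊂V) =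
      Connected-trans (go (acc recU) (recV Z⊂V) iU iZ U⊂Z) (go (recU U⊂Z) (acc recV) iZ iV Z⊂V)
    ... | no ∄Z =
      HasseEdge⇒Connected (inj₁ (iU , iV , U⊂V , λ Z iZ U⊂Z Z⊂V → ∄Z (Z , iZ , U⊂Z , Z⊂V)))

  ⊆⇒Connected : ∀ {U V} → Inner F U → Inner F V → U ⊆ V → Connected F U V
  ⊆⇒Connected {U} {V} iU iV U⊆V with U ⊂? V
  ... | yes U⊂V = ⊂⇒Connected iU iV U⊂V
  ... | no U⊄V = subst (Connected F U) (⊆-antisym U⊆V (⊆∧⊄⇒⊇ U⊆V U⊄V)) (here iU)

  comparable⇒Connected : ∀ {U V} → Inner F U → Inner F V → Comparable U V → Connected F U V
  comparable⇒Connected iU iV (inj₁ U⊆V) = ⊆⇒Connected iU iV U⊆V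
  comparable⇒Connected iU iV (inj₂ V⊆U) = Connected-sym (⊆⇒Connected iV iU V⊆U)

Candidate : ∀ {n} → Family n → Subset n → Subset n → Set
Candidate F X₀ W = W ∈F F × Between (InComponent F X₀) W

module Saturated {n} {F : Family n} (sat : NSaturated F) {X₀ : Subset n} (iX₀ : Inner F X₀)
  (G? : Decidable (InComponent F X₀)) (K? : Decidable (Candidate F X₀)) where

  private
    G : Subset n → Set
    G = InComponent F X₀

    ¬N : ¬ ContainsN (_∈F F)
    ¬N = proj₁ sat

  G⇒∈F : ∀ {Y} → G Y → Y ∈F F
  G⇒∈F = proj₁ ∘ Connected-inner

  G-closed : ∀ {Y Z} → G Y → Inner F Z → Comparable Y Z → G Z
  G-closed gY iZ Y~Z = Connected-trans gY (comparable⇒Connected (Connected-inner gY) iZ Y~Z)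

  incomparable⇒Between : ∀ {K Y} → Candidate F X₀ K → G Y → Incomparable Y K → Between G Y
  incomparable⇒Between {Y = Y} (K∈F , minimal⊆K , K⊆maximal) gY (Y⊈K , K⊈Y) =
    minimal⊆Y , Y⊆maximal
    where
    minimal⊆Y : ∀ B → MinimalIn G B → B ⊆ Y
    minimal⊆Y B B-min = decidable-stable (B ⊆? Y) (¬N ∘ N-below (minimal-below G? gY))
      where
      N-below : (∃ λ B₀ → MinimalIn G B₀ × B₀ ⊆ Y) → ¬ B ⊆ Y → ContainsN (_∈F F)
      N-below (B₀ , B₀-min , B₀⊆Y) B⊈Y =
        N-intro (G⇒∈F (proj₁ B-min)) (G⇒∈F (proj₁ B₀-min)) K∈F (G⇒∈F gY)
          (minimal⊆K B B-min) (minimal⊆K B₀ B₀-min) B₀⊆Y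
          ((λ B⊆B₀ → B⊈Y (⊆-trans B⊆B₀ B₀⊆Y)) ,
           (λ B₀⊆B → B⊈Y (⊆-trans (MinimalIn⇒⊆⇒⊇ B-min (proj₁ B₀-min) B₀⊆B) B₀⊆Y)))
          (B⊈Y , λ Y⊆B → B⊈Y (MinimalIn⇒⊆⇒⊇ B-min gY Y⊆B))
          (K⊈Y , Y⊈K)

    Y⊆maximal : ∀ A → MaximalIn G A → Y ⊆ A
    Y⊆maximal A A-max = decidable-stable (Y ⊆? A) (¬N ∘ N-above (maximal-above G? gY))
      where
      N-above : (∃ λ A₀ → MaximalIn G A₀ × Y ⊆ A₀) → ¬ Y ⊆ A → ContainsN (_∈F F)
      N-above (A₀ , A₀-max , Y⊆A₀) Y⊈A =
        N-intro (G⇒∈F gY) K∈F (G⇒∈F (proj₁ A₀-max)) (G⇒∈F (proj₁ A-max))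
          Y⊆A₀ (K⊆maximal A₀ A₀-max) (K⊆maximal A A-max)
          (Y⊈K , K⊈Y)
          (Y⊈A , λ A⊆Y → Y⊈A (MaximalIn⇒⊇⇒⊆ A-max gY A⊆Y))
          ((λ A₀⊆A → Y⊈A (⊆-trans Y⊆A₀ A₀⊆A)) ,
           (λ A⊆A₀ → Y⊈A (⊆-trans Y⊆A₀ (MaximalIn⇒⊇⇒⊆ A-max (proj₁ A₀-max) A⊆A₀))))

  W : Subset n
  W = intersection K?

  W-comparable : ∀ {Y} → G Y → Comparable Y W
  W-comparable {Y} gY with anySubset? (λ K → K? K ×-dec K ⊆? Y)
  ... | yes (K , K-cand , K⊆Y) = inj₂ (⊆-trans (intersection-⊆ K? K-cand) K⊆Y)
  ... | no ∄K = inj₁ (⊆-intersection K? Y⊆candidate)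
    where
    Y⊆candidate : ∀ {K} → Candidate F X₀ K → Y ⊆ K
    Y⊆candidate {K} K-cand with K ⊆? Y
    ... | yes K⊆Y = ⊥-elim (∄K (K , K-cand , K⊆Y))
    ... | no K⊈Y = decidable-stable (Y ⊆? K) λ Y⊈K →
      ∄K (Y , (G⇒∈F gY , incomparable⇒Between K-cand gY (Y⊈K , K⊈Y)) , ⊆-refl)

  module _ {M : Subset n} (M-cand : Candidate F X₀ M) where

    W-between : Between G W
    W-between = (λ B B-min → ⊆-intersection K? λ (_ , minimal⊆K , _) → minimal⊆K B B-min)
              , (λ A A-max → ⊆-trans (intersection-⊆ K? M-cand) (proj₂ (proj₂ M-cand) A A-max))

    comparable-W⇒G : ∀ {Y} → Inner F Y → Comparable W Y → G Y
    comparable-W⇒G iY (inj₁ W⊆Y) =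
      let B₀ , B₀-min , _ = minimal-below G? (here iX₀)
      in G-closed (proj₁ B₀-min) iY (inj₁ (⊆-trans (proj₁ W-between B₀ B₀-min) W⊆Y))
    comparable-W⇒G iY (inj₂ Y⊆W) =
      let A₀ , A₀-max , _ = maximal-above G? (here iX₀)
      in G-closed (proj₁ A₀-max) iY (inj₂ (⊆-trans Y⊆W (proj₂ W-between A₀ A₀-max)))

    -- V only witnesses that Y is neither ∅ nor [n].
    two-steps⇒¬incomparable : ∀ {Y Z V} → Insert F W Y → Insert F W Z → Incomparable Y V →
      Comparable W Y → Comparable Y Z → ¬ Incomparable W Z
    two-steps⇒¬incomparable (inj₂ refl) _ _ _ W~Z W∥Z = incomparable⇒¬comparable W∥Z W~Z
    two-steps⇒¬incomparable (inj₁ _) (inj₂ refl) _ _ _ W∥W = proj₁ W∥W ⊆-refl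
    two-steps⇒¬incomparable {Y} {Z} (inj₁ Y∈F) (inj₁ Z∈F) Y∥V W~Y Y~Z W∥Z =
      incomparable⇒¬comparable (swap W∥Z) (W-comparable gZ)
      where
      gY : G Y
      gY = comparable-W⇒G (Y∈F , incomparable⇒nontrivial Y∥V) W~Y
      gZ : G Z
      gZ = G-closed gY (Z∈F , incomparable⇒nontrivial (swap W∥Z)) Y~Z

    ¬N-insert : ¬ ContainsN (Insert F W)
    ¬N-insert (P , Q , R , S , P∈ , Q∈ , R∈ , S∈ ,
               (P⊆R , _) , (Q⊆R , _) , (Q⊆S , _) , P∥Q , P∥S , R∥S)
      with P∈ | Q∈ | R∈ | S∈
    ... | inj₂ refl | _ | _ | _ =
      two-steps⇒¬incomparable R∈ Q∈ R∥S (inj₁ P⊆R) (inj₂ Q⊆R) P∥Q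
    ... | inj₁ _ | inj₂ refl | _ | _ =
      two-steps⇒¬incomparable R∈ P∈ R∥S (inj₁ Q⊆R) (inj₂ P⊆R) (swap P∥Q)
    ... | inj₁ _ | inj₁ _ | inj₂ refl | _ =
      two-steps⇒¬incomparable Q∈ S∈ (swap P∥Q) (inj₂ Q⊆R) (inj₁ Q⊆S) R∥S
    ... | inj₁ _ | inj₁ _ | inj₁ _ | inj₂ refl =
      two-steps⇒¬incomparable Q∈ R∈ (swap P∥Q) (inj₂ Q⊆S) (inj₁ Q⊆R) (swap R∥S)
    ... | inj₁ P∈F | inj₁ Q∈F | inj₁ R∈F | inj₁ S∈F =
      ¬N (N-intro P∈F Q∈F R∈F S∈F P⊆R Q⊆R Q⊆S P∥Q P∥S R∥S)

    W∈F : W ∈F F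
    W∈F with F W in eq
    ... | true = refl
    ... | false = contradiction (proj₂ sat W eq) ¬N-insert

  comparable-to-minimal-candidate : ∀ {M X} → Candidate F X₀ M →
    (∀ M′ → Candidate F X₀ M′ → ¬ M′ ⊂ M) → G X → Comparable X M
  comparable-to-minimal-candidate {M} {X} M-cand M-minimal gX =
    subst (Comparable X) W≡M (W-comparable gX)
    where
    W⊆M : W ⊆ M
    W⊆M = intersection-⊆ K? M-cand
    W≡M : W ≡ M
    W≡M = ⊆-antisym W⊆M (⊆∧⊄⇒⊇ W⊆M (M-minimal W (W∈F M-cand , W-between M-cand)))

lemma2p5 : (n : ℕ) (F : Family n) → NSaturated F →
    (X₀ : Subset n) → Inner F X₀ →
    (M : Subset n) → M ∈F F → Between (InComponent F X₀) M →
    (∀ (M′ : Subset n) → M′ ∈F F → Between (InComponent F X₀) M′ → ¬ (M′ ⊂ M)) →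
    ∀ (X : Subset n) → InComponent F X₀ X → X ⊆ M ⊎ M ⊆ X
lemma2p5 n F sat X₀ iX₀ M M∈F M-between M-minimal X gX =
  decidable-stable (comparable? X M) (do
    G? ← ¬¬-decidable (InComponent F X₀)
    K? ← ¬¬-decidable (Candidate F X₀)
    return (Saturated.comparable-to-minimal-candidate sat iX₀ G? K? (M∈F , M-between)
             (λ M′ (M′∈F , M′-between) → M-minimal M′ M′∈F M′-between) gX))
  where open RawMonad ¬¬-Monad
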